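{- Let $\Gamma$ be a graph of order $n$ with degree $d$, diameter $D$ and cyclic defect, with adjacency matrix $A$ and with $G_{d,D}(A)=J_n+B$ where $B$ is a cycle matrix. If $n\equiv0\pmod 4$, then the kernel $\ker(B)$ is invariant under $A$, and the restriction of $A$ to $\ker(B)$ has even trace.
   Context: For an integer $d\ge 1$ define polynomials $G_{d,m}(x)$ by $G_{d,0}(x)=1$, $G_{d,1}(x)=x+1$, and $G_{d,m+1}(x)=xG_{d,m}(x)-(d-1)G_{d,m-1}(x)$ for $m\ge1$. Let $J_n$ be the $n\times n$ all-ones matrix. For a graph on $n\ge3$ vertices, a cycle matrix is the adjacency matrix $B$ of an $n$-cycle on the same vertex set (i.e., for some ordering $v_1,\dots,v_n$ of the vertices, $B_{ij}=1$ iff $v_i,v_j$ are cyclically consecutive, and $0$ otherwise); this cycle need not consist of edges of the graph. A graph $\Gamma$ of order $n$ with adjacency matrix $A$ is a graph of degree $d$, diameter $D$ and cyclic defect if $\Gamma$ is $d$-regular with $d\ge3$, has diameter $D\ge2$, and $G_{d,D}(A)=J_n+B$ for some cycle matrix $B$. When $4\mid n$, $\ker(B)$ is $2$-dimensional (spanned, in the cycle ordering, by $(1,0,-1,0,1,\dots)^T$ and $(0,1,0,-1,0,\dots)^T$), and the restriction of $A$ is the $2\times2$ matrix of $A$ acting on it. -}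

module Defs where

open import Data.Nat as ℕ using (ℕ; zero; suc; _≤_; _<_)
open import Data.Nat.DivMod using (_%_)
open import Data.Fin using (Fin; toℕ) renaming (zero to fzero; suc to fsuc)
open import Data.Integer as ℤ using (ℤ; +_; _+_; _*_; _-_)
open import Data.Product using (Σ; ∃; ∃-syntax; _×_; _,_)
open import Data.Sum using (_⊎_)
open import Relation.Nullary using (¬_)
open import Relation.Binary.PropositionalEquality using (_≡_)
open import Function.Bundles using (_↔_; Inverse)

Vector : ℕ → Set
Vector n = Fin n → ℤ

Matrix : ℕ → Set
Matrix n = Fin n → Fin n → ℤ

∑ : ∀ n → (Fin n → ℤ) → ℤ
∑ zero    f = + 0
∑ (suc n) f = f fzero + ∑ n (λ i → f (fsuc i))

infixl 7 _⊗_ _·_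
infixl 6 _⊕_ _⊖_

_⊗_ : ∀ {n} → Matrix n → Matrix n → Matrix n
_⊗_ {n} M N i j = ∑ n (λ k → M i k * N k j)

_⊕_ : ∀ {n} → Matrix n → Matrix n → Matrix n
(M ⊕ N) i j = M i j + N i j

_⊖_ : ∀ {n} → Matrix n → Matrix n → Matrix n
(M ⊖ N) i j = M i j - N i j

_·_ : ∀ {n} → ℤ → Matrix n → Matrix n
(c · M) i j = c * M i j

_▷_ : ∀ {n} → Matrix n → Vector n → Vector n
_▷_ {n} M x i = ∑ n (λ k → M i k * x k)

zeroV : ∀ {n} → Vector n
zeroV _ = + 0

I : ∀ {n} → Matrix n
I i j with toℕ i ℕ.≟ toℕ j
... | Relation.Nullary.yes _ = + 1
... | Relation.Nullary.no  _ = + 0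

J : ∀ {n} → Matrix n
J _ _ = + 1

G : ∀ {n} → ℕ → ℕ → Matrix n → Matrix n
G d zero          A = I
G d (suc zero)    A = A ⊕ I
G d (suc (suc m)) A = (A ⊗ G d (suc m) A) ⊖ ((+ (d ℕ.∸ 1)) · G d m A)

record IsAdjacencyMatrix {n : ℕ} (A : Matrix n) : Set where
  field
    zero-one  : ∀ i j → A i j ≡ + 0 ⊎ A i j ≡ + 1
    symmetric : ∀ i j → A i j ≡ A j i
    loopless  : ∀ i → A i i ≡ + 0

data Walk {n : ℕ} (A : Matrix n) : Fin n → Fin n → ℕ → Set where
  here : ∀ {i} → Walk A i i 0
  step : ∀ {i j l k} → A i j ≡ + 1 → Walk A j l k → Walk A i l (suc k)

DistLe : ∀ {n} → Matrix n → Fin n → Fin n → ℕ → Set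
DistLe A i j k = ∃[ m ] (m ≤ k × Walk A i j m)

IsRegular : ∀ {n} → Matrix n → ℕ → Set
IsRegular {n} A d = ∀ i → ∑ n (λ j → A i j) ≡ + d

HasDiameter : ∀ {n} → Matrix n → ℕ → Set
HasDiameter {n} A D =
  (∀ i j → DistLe A i j D) × ∃[ i ] ∃[ j ] ¬ DistLe A i j (D ℕ.∸ 1)

Follows : ∀ {n} → Fin n → Fin n → Set
Follows {n} a b = toℕ b ≡ suc (toℕ a) ⊎ (suc (toℕ a) ≡ n × toℕ b ≡ 0)

-- B is the adjacency matrix of the n-cycle v_1,...,v_n where v_(i+1) = to σ i
IsCycleMatrixFor : ∀ {n} → Matrix n → (Fin n ↔ Fin n) → Set
IsCycleMatrixFor {n} B σ =
  3 ≤ n ×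
  (∀ a b → (Follows a b ⊎ Follows b a) → B (to a) (to b) ≡ + 1) ×
  (∀ a b → ¬ (Follows a b ⊎ Follows b a) → B (to a) (to b) ≡ + 0)
  where open Inverse σ

IsCycleMatrix : ∀ {n} → Matrix n → Set
IsCycleMatrix {n} B = Σ (Fin n ↔ Fin n) (IsCycleMatrixFor B)

record CyclicDefect {n : ℕ} (A : Matrix n) (d D : ℕ) (B : Matrix n) : Set where
  field
    adjacency : IsAdjacencyMatrix A
    regular   : IsRegular A d
    d≥3       : 3 ≤ d
    diameter  : HasDiameter A D
    D≥2       : 2 ≤ D
    cycle     : IsCycleMatrix B
    equation  : ∀ i j → G d D A i j ≡ (J ⊕ B) i j

pat₀ : ℕ → ℤ
pat₀ k with k % 4
... | 0 = + 1
... | 2 = ℤ.- (+ 1)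
... | _ = + 0

pat₁ : ℕ → ℤ
pat₁ k with k % 4
... | 1 = + 1
... | 3 = ℤ.- (+ 1)
... | _ = + 0

-- spanning vectors of ker(B) in the cycle ordering σ
kerU kerW : ∀ {n} → (Fin n ↔ Fin n) → Vector n
kerU σ x = pat₀ (toℕ (Inverse.from σ x))
kerW σ x = pat₁ (toℕ (Inverse.from σ x))

_+ᵥ_ : ∀ {n} → Vector n → Vector n → Vector n
(x +ᵥ y) i = x i + y i

_*ᵥ_ : ∀ {n} → ℤ → Vector n → Vector n
(c *ᵥ x) i = c * x i

-- B = G_{d,D}(A) - J, and A commutes with every polynomial in A and, being symmetric and
-- d-regular, with J; so A commutes with B and preserves ker B. In cycle coordinates B y = 0 says
-- y(v_{k+2}) = -y(v_k), so ker B is spanned by U = (1,0,-1,0,...) and W = (0,1,0,-1,...), which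
-- lie in ker B when 4 ∣ n. Write A U = aU + bW and A W = cU + eW. Since U ⊥ W and both have norm
-- n/2, the symmetry of A gives c = b. Since U + W has odd entries, A (U + W) ≡ A 1 = d (mod 2)
-- entrywise; at v₁ and v₂ this reads a + c ≡ b + e ≡ d, hence a + e ≡ 2d - 2b ≡ 0 (mod 2).

module Submission where

open import Defs
open import Data.Nat as ℕ using (ℕ; zero; suc; _≤_; _<_; s≤s; z≤n)
import Data.Nat.Properties as ℕP
open import Data.Nat.Divisibility using (_∣_; divides)
open import Data.Integer using (ℤ; _+_; +_; _*_; _-_; -_; -1ℤ; NonZero)
open import Data.Integer.Properties
open import Data.Integer.Tactic.RingSolver using (solve-∀)
open import Data.Integer.Divisibility using () renaming (_∣_ to _∣ℤ_)
open import Data.Integer.Divisibility.Signed as Signed using (∣n⇒∣m*n; ∣m∣n⇒∣m+n; ∣⇒∣ᵤ)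
open import Algebra.Properties.AbelianGroup +-0-abelianGroup using (inverseˡ-unique)
import Algebra.Properties.Semiring.Sum +-*-semiring as Sum
open import Data.Fin using (Fin; toℕ; fromℕ; fromℕ<; inject₁; punchIn)
  renaming (zero to fzero; suc to fsuc)
import Data.Fin.Properties as FinP
open import Data.Product using (_×_; ∃-syntax; _,_; proj₁; proj₂)
open import Data.Sum using (_⊎_; inj₁; inj₂)
open import Data.Empty using (⊥-elim)
open import Function.Base using (_∘_)
open import Function.Bundles using (_↔_; Inverse)
open import Relation.Nullary using (yes; no; ¬_)
open import Relation.Binary.PropositionalEquality
  using (_≡_; _≢_; refl; sym; trans; cong; cong₂; subst; _≗_; module ≡-Reasoning)

∑≗sum : ∀ n (f : Fin n → ℤ) → ∑ n f ≡ Sum.sum f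
∑≗sum zero    f = refl
∑≗sum (suc n) f = cong (λ s → f fzero + s) (∑≗sum n (f ∘ fsuc))

module _ (n : ℕ) where

  ∑-via-sum : {f g : Fin n → ℤ} → Sum.sum f ≡ Sum.sum g → ∑ n f ≡ ∑ n g
  ∑-via-sum {f} {g} eq = trans (∑≗sum n f) (trans eq (sym (∑≗sum n g)))

  ∑-cong : {f g : Fin n → ℤ} → f ≗ g → ∑ n f ≡ ∑ n g
  ∑-cong f≗g = ∑-via-sum (Sum.sum-cong-≗ f≗g)

  ∑-zero : ∑ n (λ _ → + 0) ≡ + 0
  ∑-zero = trans (∑≗sum n _) (Sum.sum-replicate-zero n)

  ∑-+ : ∀ (f g : Fin n → ℤ) → ∑ n (λ i → f i + g i) ≡ ∑ n f + ∑ n g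
  ∑-+ f g = trans (∑≗sum n _)
    (trans (Sum.∑-distrib-+ f g) (sym (cong₂ _+_ (∑≗sum n f) (∑≗sum n g))))

  ∑-*ˡ : ∀ c (f : Fin n → ℤ) → ∑ n (λ i → c * f i) ≡ c * ∑ n f
  ∑-*ˡ c f = trans (∑≗sum n _)
    (trans (sym (Sum.*-distribˡ-sum c f)) (cong (c *_) (sym (∑≗sum n f))))

  ∑-*ʳ : ∀ c (f : Fin n → ℤ) → ∑ n (λ i → f i * c) ≡ ∑ n f * c
  ∑-*ʳ c f = trans (∑-cong (λ i → *-comm (f i) c)) (trans (∑-*ˡ c f) (*-comm c _))

  ∑-minus : ∀ (f g : Fin n → ℤ) → ∑ n (λ i → f i - g i) ≡ ∑ n f - ∑ n g
  ∑-minus f g = begin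
    ∑ n (λ i → f i - g i)              ≡⟨ ∑-+ f (λ i → - g i) ⟩
    ∑ n f + ∑ n (λ i → - g i)          ≡⟨ cong (λ s → ∑ n f + s) (∑-cong (λ i → sym (-1*i≡-i (g i)))) ⟩
    ∑ n f + ∑ n (λ i → -1ℤ * g i)      ≡⟨ cong (λ s → ∑ n f + s) (trans (∑-*ˡ -1ℤ g) (-1*i≡-i _)) ⟩
    ∑ n f - ∑ n g                      ∎
    where open ≡-Reasoning

  ∑-permute : ∀ (f : Fin n → ℤ) (σ : Fin n ↔ Fin n) → ∑ n f ≡ ∑ n (f ∘ Inverse.to σ)
  ∑-permute f σ = ∑-via-sum (Sum.∑-permute f σ)

∑-swap : ∀ m n (f : Fin m → Fin n → ℤ) →
         ∑ m (λ i → ∑ n (f i)) ≡ ∑ n (λ j → ∑ m (λ i → f i j))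
∑-swap m n f = trans (∑∑≗sumsum m n f)
  (trans (Sum.∑-comm f) (sym (∑∑≗sumsum n m (λ j i → f i j))))
  where
  ∑∑≗sumsum : ∀ m n (f : Fin m → Fin n → ℤ) →
              ∑ m (λ i → ∑ n (f i)) ≡ Sum.sum (λ i → Sum.sum (f i))
  ∑∑≗sumsum m n f = trans (∑-cong m (λ i → ∑≗sum n (f i))) (∑≗sum m _)

∣-∑ : ∀ {k} n {f : Fin n → ℤ} → (∀ i → k Signed.∣ f i) → k Signed.∣ ∑ n f
∣-∑ {k} zero    _   = Signed.divides (+ 0) (sym (*-zeroˡ k))
∣-∑     (suc n) k∣f = ∣m∣n⇒∣m+n (k∣f fzero) (∣-∑ n (k∣f ∘ fsuc))

I-diagonal : ∀ {n} (k : Fin n) → I k k ≡ + 1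
I-diagonal k with toℕ k ℕ.≟ toℕ k
... | yes _  = refl
... | no k≢k = ⊥-elim (k≢k refl)

I-off-diagonal : ∀ {n} {k j : Fin n} → k ≢ j → I k j ≡ + 0
I-off-diagonal {k = k} {j} k≢j with toℕ k ℕ.≟ toℕ j
... | yes eq = ⊥-elim (k≢j (FinP.toℕ-injective eq))
... | no _   = refl

∑-δ : ∀ {n} (k : Fin n) (g : Fin n → ℤ) → ∑ n (λ j → I k j * g j) ≡ g k
∑-δ {suc n} k g = begin
  ∑ (suc n) t                         ≡⟨ ∑≗sum (suc n) t ⟩
  Sum.sum t                           ≡⟨ Sum.sum-remove t ⟩
  t k + Sum.sum (t ∘ punchIn k)       ≡⟨ cong₂ _+_ (cong (_* g k) (I-diagonal k)) rest≡0 ⟩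
  + 1 * g k + + 0                     ≡⟨ trans (+-identityʳ _) (*-identityˡ (g k)) ⟩
  g k                                 ∎
  where
  open ≡-Reasoning
  t : Fin (suc n) → ℤ
  t j = I k j * g j
  rest≡0 : Sum.sum (t ∘ punchIn k) ≡ + 0
  rest≡0 = trans (Sum.sum-cong-≗ (λ i → cong (_* g (punchIn k i))
                   (I-off-diagonal (FinP.punchInᵢ≢i k i ∘ sym))))
                 (trans (Sum.sum-cong-≗ (λ i → *-zeroˡ (g (punchIn k i))))
                        (Sum.sum-replicate-zero n))

infixl 6 _-ᵥ_

_-ᵥ_ : ∀ {n} → Vector n → Vector n → Vector n
(x -ᵥ y) i = x i - y i

IsSymmetric : ∀ {n} → Matrix n → Set
IsSymmetric M = ∀ i j → M i j ≡ M j i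

record Commute {n} (A M : Matrix n) : Set where
  constructor commuting
  field ▷-commute : ∀ x → M ▷ (A ▷ x) ≗ A ▷ (M ▷ x)
open Commute

module _ {n : ℕ} where

  ▷-cong : ∀ (M : Matrix n) {x y : Vector n} → x ≗ y → M ▷ x ≗ M ▷ y
  ▷-cong M x≗y i = ∑-cong n (λ k → cong (M i k *_) (x≗y k))

  ▷-congˡ : ∀ {M N : Matrix n} → (∀ i j → M i j ≡ N i j) → ∀ x → M ▷ x ≗ N ▷ x
  ▷-congˡ M≡N x i = ∑-cong n (λ k → cong (_* x k) (M≡N i k))

  ▷-+ᵥ : ∀ (M : Matrix n) x y → M ▷ (x +ᵥ y) ≗ (M ▷ x) +ᵥ (M ▷ y)
  ▷-+ᵥ M x y i = trans (∑-cong n (λ k → *-distribˡ-+ (M i k) (x k) (y k))) (∑-+ n _ _)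

  ▷-*ᵥ : ∀ (M : Matrix n) c x → M ▷ (c *ᵥ x) ≗ c *ᵥ (M ▷ x)
  ▷-*ᵥ M c x i = trans (∑-cong n (λ k → *-comm-middle (M i k) c (x k))) (∑-*ˡ n c _)
    where
    *-comm-middle : ∀ a b e → a * (b * e) ≡ b * (a * e)
    *-comm-middle = solve-∀

  ▷-minusᵥ : ∀ (M : Matrix n) x y → M ▷ (x -ᵥ y) ≗ (M ▷ x) -ᵥ (M ▷ y)
  ▷-minusᵥ M x y i = trans (∑-cong n (λ k → *-distribˡ-minus (M i k) (x k) (y k))) (∑-minus n _ _)
    where
    *-distribˡ-minus : ∀ a b e → a * (b - e) ≡ a * b - a * e
    *-distribˡ-minus = solve-∀

  ⊕-▷ : ∀ (M N : Matrix n) x → (M ⊕ N) ▷ x ≗ (M ▷ x) +ᵥ (N ▷ x)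
  ⊕-▷ M N x i = trans (∑-cong n (λ k → *-distribʳ-+ (x k) (M i k) (N i k))) (∑-+ n _ _)

  ⊖-▷ : ∀ (M N : Matrix n) x → (M ⊖ N) ▷ x ≗ (M ▷ x) -ᵥ (N ▷ x)
  ⊖-▷ M N x i = trans (∑-cong n (λ k → *-distribʳ-minus (M i k) (N i k) (x k))) (∑-minus n _ _)
    where
    *-distribʳ-minus : ∀ a b e → (a - b) * e ≡ a * e - b * e
    *-distribʳ-minus = solve-∀

  ·-▷ : ∀ c (M : Matrix n) x → (c · M) ▷ x ≗ c *ᵥ (M ▷ x)
  ·-▷ c M x i = trans (∑-cong n (λ k → *-assoc c (M i k) (x k))) (∑-*ˡ n c _)

  ⊗-▷ : ∀ (M N : Matrix n) x → (M ⊗ N) ▷ x ≗ M ▷ (N ▷ x)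
  ⊗-▷ M N x i = begin
    ∑ n (λ k → ∑ n (λ l → M i l * N l k) * x k)   ≡⟨ ∑-cong n (λ k → sym (∑-*ʳ n (x k) _)) ⟩
    ∑ n (λ k → ∑ n (λ l → M i l * N l k * x k))   ≡⟨ ∑-swap n n _ ⟩
    ∑ n (λ l → ∑ n (λ k → M i l * N l k * x k))   ≡⟨ ∑-cong n (λ l → ∑-cong n (λ k → *-assoc (M i l) _ _)) ⟩
    ∑ n (λ l → ∑ n (λ k → M i l * (N l k * x k))) ≡⟨ ∑-cong n (λ l → ∑-*ˡ n (M i l) _) ⟩
    ∑ n (λ l → M i l * ∑ n (λ k → N l k * x k))   ∎
    where open ≡-Reasoning

  I-▷ : ∀ (x : Vector n) → I ▷ x ≗ x
  I-▷ x i = ∑-δ i x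

  J-▷ : ∀ (x : Vector n) → J ▷ x ≗ λ _ → ∑ n x
  J-▷ x i = ∑-cong n (λ k → *-identityˡ (x k))

  ▷-zeroV : ∀ (M : Matrix n) → M ▷ zeroV ≗ zeroV
  ▷-zeroV M i = trans (∑-cong n (λ k → *-zeroʳ (M i k))) (∑-zero n)

  ▷-const : ∀ {d} {A : Matrix n} → IsRegular A d → ∀ c → A ▷ (λ _ → c) ≗ λ _ → + d * c
  ▷-const {d} {A} regular c i = trans (∑-*ʳ n c (A i)) (cong (_* c) (regular i))

  ∑-▷ : ∀ {d} {A : Matrix n} → IsSymmetric A → IsRegular A d → ∀ x → ∑ n (A ▷ x) ≡ + d * ∑ n x
  ∑-▷ {d} {A} symmetric regular x = begin
    ∑ n (λ i → ∑ n (λ k → A i k * x k)) ≡⟨ ∑-swap n n _ ⟩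
    ∑ n (λ k → ∑ n (λ i → A i k * x k)) ≡⟨ ∑-cong n (λ k → ∑-*ʳ n (x k) (λ i → A i k)) ⟩
    ∑ n (λ k → ∑ n (λ i → A i k) * x k) ≡⟨ ∑-cong n (λ k → cong (_* x k) column-sum) ⟩
    ∑ n (λ k → + d * x k)               ≡⟨ ∑-*ˡ n (+ d) x ⟩
    + d * ∑ n x                         ∎
    where
    open ≡-Reasoning
    column-sum : ∀ {k} → ∑ n (λ i → A i k) ≡ + d
    column-sum {k} = trans (∑-cong n (λ i → symmetric i k)) (regular k)

module _ {n : ℕ} {A : Matrix n} where

  Commute-refl : Commute A A
  Commute-refl = commuting λ x i → refl

  Commute-I : Commute A I
  Commute-I = commuting λ x i → trans (I-▷ (A ▷ x) i) (sym (▷-cong A (I-▷ x) i))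

  Commute-⊕ : ∀ {M N} → Commute A M → Commute A N → Commute A (M ⊕ N)
  Commute-⊕ {M} {N} A↔M A↔N = commuting λ x i → begin
    ((M ⊕ N) ▷ (A ▷ x)) i                   ≡⟨ ⊕-▷ M N (A ▷ x) i ⟩
    (M ▷ (A ▷ x)) i + (N ▷ (A ▷ x)) i       ≡⟨ cong₂ _+_ (▷-commute A↔M x i) (▷-commute A↔N x i) ⟩
    (A ▷ (M ▷ x)) i + (A ▷ (N ▷ x)) i       ≡⟨ ▷-+ᵥ A _ _ i ⟨
    (A ▷ ((M ▷ x) +ᵥ (N ▷ x))) i            ≡⟨ ▷-cong A (⊕-▷ M N x) i ⟨
    (A ▷ ((M ⊕ N) ▷ x)) i                   ∎
    where open ≡-Reasoning

  Commute-⊖ : ∀ {M N} → Commute A M → Commute A N → Commute A (M ⊖ N)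
  Commute-⊖ {M} {N} A↔M A↔N = commuting λ x i → begin
    ((M ⊖ N) ▷ (A ▷ x)) i                   ≡⟨ ⊖-▷ M N (A ▷ x) i ⟩
    (M ▷ (A ▷ x)) i - (N ▷ (A ▷ x)) i       ≡⟨ cong₂ _-_ (▷-commute A↔M x i) (▷-commute A↔N x i) ⟩
    (A ▷ (M ▷ x)) i - (A ▷ (N ▷ x)) i       ≡⟨ ▷-minusᵥ A _ _ i ⟨
    (A ▷ ((M ▷ x) -ᵥ (N ▷ x))) i            ≡⟨ ▷-cong A (⊖-▷ M N x) i ⟨
    (A ▷ ((M ⊖ N) ▷ x)) i                   ∎
    where open ≡-Reasoning

  Commute-· : ∀ c {M} → Commute A M → Commute A (c · M)
  Commute-· c {M} A↔M = commuting λ x i → begin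
    ((c · M) ▷ (A ▷ x)) i     ≡⟨ ·-▷ c M (A ▷ x) i ⟩
    c * (M ▷ (A ▷ x)) i       ≡⟨ cong (c *_) (▷-commute A↔M x i) ⟩
    c * (A ▷ (M ▷ x)) i       ≡⟨ ▷-*ᵥ A c _ i ⟨
    (A ▷ (c *ᵥ (M ▷ x))) i    ≡⟨ ▷-cong A (·-▷ c M x) i ⟨
    (A ▷ ((c · M) ▷ x)) i     ∎
    where open ≡-Reasoning

  Commute-⊗ : ∀ {M N} → Commute A M → Commute A N → Commute A (M ⊗ N)
  Commute-⊗ {M} {N} A↔M A↔N = commuting λ x i → begin
    ((M ⊗ N) ▷ (A ▷ x)) i     ≡⟨ ⊗-▷ M N (A ▷ x) i ⟩
    (M ▷ (N ▷ (A ▷ x))) i     ≡⟨ ▷-cong M (▷-commute A↔N x) i ⟩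
    (M ▷ (A ▷ (N ▷ x))) i     ≡⟨ ▷-commute A↔M (N ▷ x) i ⟩
    (A ▷ (M ▷ (N ▷ x))) i     ≡⟨ ▷-cong A (⊗-▷ M N x) i ⟨
    (A ▷ ((M ⊗ N) ▷ x)) i     ∎
    where open ≡-Reasoning

  Commute-congʳ : ∀ {M N} → (∀ i j → M i j ≡ N i j) → Commute A M → Commute A N
  Commute-congʳ {M} {N} M≡N A↔M = commuting λ x i → begin
    (N ▷ (A ▷ x)) i   ≡⟨ ▷-congˡ M≡N (A ▷ x) i ⟨
    (M ▷ (A ▷ x)) i   ≡⟨ ▷-commute A↔M x i ⟩
    (A ▷ (M ▷ x)) i   ≡⟨ ▷-cong A (▷-congˡ M≡N x) i ⟩
    (A ▷ (N ▷ x)) i   ∎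
    where open ≡-Reasoning

  Commute-G : ∀ d m → Commute A (G d m A)
  Commute-G d zero          = Commute-I
  Commute-G d (suc zero)    = Commute-⊕ Commute-refl Commute-I
  Commute-G d (suc (suc m)) =
    Commute-⊖ (Commute-⊗ Commute-refl (Commute-G d (suc m)))
              (Commute-· (+ (d ℕ.∸ 1)) (Commute-G d m))

  Commute-J : ∀ {d} → IsSymmetric A → IsRegular A d → Commute A J
  Commute-J {d} symmetric regular = commuting λ x i → begin
    (J ▷ (A ▷ x)) i            ≡⟨ J-▷ (A ▷ x) i ⟩
    ∑ n (A ▷ x)                ≡⟨ ∑-▷ symmetric regular x ⟩
    + d * ∑ n x                ≡⟨ ▷-const regular (∑ n x) i ⟨
    (A ▷ (λ _ → ∑ n x)) i      ≡⟨ ▷-cong A (J-▷ x) i ⟨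
    (A ▷ (J ▷ x)) i            ∎
    where open ≡-Reasoning

  ker-invariant : ∀ {B} → Commute A B → ∀ x → B ▷ x ≗ zeroV → B ▷ (A ▷ x) ≗ zeroV
  ker-invariant {B} A↔B x Bx≗0 i = begin
    (B ▷ (A ▷ x)) i   ≡⟨ ▷-commute A↔B x i ⟩
    (A ▷ (B ▷ x)) i   ≡⟨ ▷-cong A Bx≗0 i ⟩
    (A ▷ zeroV) i     ≡⟨ ▷-zeroV A i ⟩
    + 0               ∎
    where open ≡-Reasoning

CyclicDefect⇒Commute : ∀ {n d D} {A B : Matrix n} → CyclicDefect A d D B → Commute A B
CyclicDefect⇒Commute {d = d} {D} {A} {B} cd =
  Commute-congʳ B≡G⊖J (Commute-⊖ (Commute-G d D) (Commute-J symmetric regular))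
  where
  open CyclicDefect cd
  open IsAdjacencyMatrix adjacency
  B≡G⊖J : ∀ i j → (G d D A ⊖ J) i j ≡ B i j
  B≡G⊖J i j = trans (cong (_- + 1) (equation i j)) (+-cancel-1 (B i j))
    where
    +-cancel-1 : ∀ b → (+ 1 + b) - + 1 ≡ b
    +-cancel-1 = solve-∀

module _ {n : ℕ} where

  ⟨_,_⟩ : Vector n → Vector n → ℤ
  ⟨ x , y ⟩ = ∑ n (λ i → x i * y i)

  ⟨⟩-comm : ∀ x y → ⟨ x , y ⟩ ≡ ⟨ y , x ⟩
  ⟨⟩-comm x y = ∑-cong n (λ i → *-comm (x i) (y i))

  ⟨⟩-▷ : ∀ {M : Matrix n} → IsSymmetric M → ∀ x y → ⟨ x , M ▷ y ⟩ ≡ ⟨ M ▷ x , y ⟩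
  ⟨⟩-▷ {M} symmetric x y = begin
    ∑ n (λ i → x i * ∑ n (λ k → M i k * y k))   ≡⟨ ∑-cong n (λ i → ∑-*ˡ n (x i) _) ⟨
    ∑ n (λ i → ∑ n (λ k → x i * (M i k * y k))) ≡⟨ ∑-swap n n _ ⟩
    ∑ n (λ k → ∑ n (λ i → x i * (M i k * y k))) ≡⟨ ∑-cong n (λ k → ∑-cong n (λ i → transpose i k)) ⟩
    ∑ n (λ k → ∑ n (λ i → M k i * x i * y k))   ≡⟨ ∑-cong n (λ k → ∑-*ʳ n (y k) _) ⟩
    ∑ n (λ k → ∑ n (λ i → M k i * x i) * y k)   ∎
    where
    open ≡-Reasoning
    reassoc : ∀ u v w → u * (v * w) ≡ v * u * w
    reassoc = solve-∀
    transpose : ∀ i k → x i * (M i k * y k) ≡ M k i * x i * y k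
    transpose i k = trans (reassoc (x i) (M i k) (y k)) (cong (λ m → m * x i * y k) (symmetric i k))

  ⟨⟩-combination : ∀ x {z} c u e w → z ≗ (c *ᵥ u) +ᵥ (e *ᵥ w) →
                   ⟨ x , z ⟩ ≡ c * ⟨ x , u ⟩ + e * ⟨ x , w ⟩
  ⟨⟩-combination x {z} c u e w z≗cu+ew = begin
    ∑ n (λ i → x i * z i)
      ≡⟨ ∑-cong n (λ i → trans (cong (x i *_) (z≗cu+ew i)) (distrib (x i) c (u i) e (w i))) ⟩
    ∑ n (λ i → c * (x i * u i) + e * (x i * w i))
      ≡⟨ ∑-+ n _ _ ⟩
    ∑ n (λ i → c * (x i * u i)) + ∑ n (λ i → e * (x i * w i))
      ≡⟨ cong₂ _+_ (∑-*ˡ n c _) (∑-*ˡ n e _) ⟩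
    c * ⟨ x , u ⟩ + e * ⟨ x , w ⟩
      ∎
    where
    open ≡-Reasoning
    distrib : ∀ s c u e w → s * (c * u + e * w) ≡ c * (s * u) + e * (s * w)
    distrib = solve-∀

  restriction-symmetric : ∀ {A : Matrix n} → IsSymmetric A →
    ∀ {u w : Vector n} {N} .{{_ : NonZero N}} → ⟨ u , w ⟩ ≡ + 0 → ⟨ u , u ⟩ ≡ N → ⟨ w , w ⟩ ≡ N →
    ∀ {a b c e} → A ▷ u ≗ (a *ᵥ u) +ᵥ (b *ᵥ w) → A ▷ w ≗ (c *ᵥ u) +ᵥ (e *ᵥ w) → c ≡ b
  restriction-symmetric {A} symmetric {u} {w} {N} uw≡0 uu≡N ww≡N {a} {b} {c} {e} Au Aw =
    *-cancelʳ-≡ c b N (begin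
      c * N                         ≡⟨ drop-zero c e N ⟩
      c * N + e * + 0               ≡⟨ cong₂ (λ s t → c * s + e * t) uu≡N uw≡0 ⟨
      c * ⟨ u , u ⟩ + e * ⟨ u , w ⟩ ≡⟨ ⟨⟩-combination u c u e w Aw ⟨
      ⟨ u , A ▷ w ⟩                 ≡⟨ ⟨⟩-▷ symmetric u w ⟩
      ⟨ A ▷ u , w ⟩                 ≡⟨ ⟨⟩-comm (A ▷ u) w ⟩
      ⟨ w , A ▷ u ⟩                 ≡⟨ ⟨⟩-combination w a u b w Au ⟩
      a * ⟨ w , u ⟩ + b * ⟨ w , w ⟩ ≡⟨ cong₂ (λ s t → a * s + b * t) (trans (⟨⟩-comm w u) uw≡0) ww≡N ⟩
      a * + 0 + b * N               ≡⟨ trans (cong (_+ b * N) (*-zeroʳ a)) (+-identityˡ _) ⟩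
      b * N                         ∎)
    where
    open ≡-Reasoning
    drop-zero : ∀ c e N → c * N ≡ c * N + e * + 0
    drop-zero = solve-∀

  ▷-cong-mod : ∀ (M : Matrix n) {k} (x y : Vector n) → (∀ j → k Signed.∣ x j - y j) →
               ∀ i → k Signed.∣ (M ▷ x) i - (M ▷ y) i
  ▷-cong-mod M x y k∣x-y i =
    subst (Signed._∣_ _) (▷-minusᵥ M x y i) (∣-∑ n (λ j → ∣n⇒∣m*n (M i j) (k∣x-y j)))

Follows-next : ∀ {n} (a : Fin n) → ∃[ b ] Follows a b
Follows-next {suc m} a with suc (toℕ a) ℕ.≟ suc m
... | yes a-last = fzero , inj₂ (a-last , refl)
... | no  a≢last = fromℕ< a+1<n , inj₁ (FinP.toℕ-fromℕ< a+1<n)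
  where
  a+1<n : suc (toℕ a) < suc m
  a+1<n = ℕP.≤∧≢⇒< (FinP.toℕ<n a) a≢last

Follows-prev : ∀ {n} (b : Fin n) → ∃[ a ] Follows a b
Follows-prev {suc m} fzero    = fromℕ m , inj₂ (cong suc (FinP.toℕ-fromℕ m) , refl)
Follows-prev {suc m} (fsuc b) = inject₁ b , inj₁ (cong suc (sym (FinP.toℕ-inject₁ b)))

Follows-functional : ∀ {n} {a b b′ : Fin n} → Follows a b → Follows a b′ → b ≡ b′
Follows-functional (inj₁ b≡a+1) (inj₁ b′≡a+1) = FinP.toℕ-injective (trans b≡a+1 (sym b′≡a+1))
Follows-functional {b = b} (inj₁ b≡a+1) (inj₂ (a-last , _)) =
  ⊥-elim (ℕP.<-irrefl (trans b≡a+1 a-last) (FinP.toℕ<n b))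
Follows-functional {b′ = b′} (inj₂ (a-last , _)) (inj₁ b′≡a+1) =
  ⊥-elim (ℕP.<-irrefl (trans b′≡a+1 a-last) (FinP.toℕ<n b′))
Follows-functional (inj₂ (_ , b≡0)) (inj₂ (_ , b′≡0)) = FinP.toℕ-injective (trans b≡0 (sym b′≡0))

Follows-injective : ∀ {n} {a a′ b : Fin n} → Follows a b → Follows a′ b → a ≡ a′
Follows-injective (inj₁ b≡a+1) (inj₁ b≡a′+1) =
  FinP.toℕ-injective (ℕP.suc-injective (trans (sym b≡a+1) b≡a′+1))
Follows-injective (inj₁ b≡a+1) (inj₂ (_ , b≡0)) with trans (sym b≡a+1) b≡0
... | ()
Follows-injective (inj₂ (_ , b≡0)) (inj₁ b≡a′+1) with trans (sym b≡a′+1) b≡0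
... | ()
Follows-injective (inj₂ (a-last , _)) (inj₂ (a′-last , _)) =
  FinP.toℕ-injective (ℕP.suc-injective (trans a-last (sym a′-last)))

Follows-both⇒≤2 : ∀ {n} {a b : Fin n} → Follows a b → Follows b a → n ≤ 2
Follows-both⇒≤2 {a = a} (inj₁ b≡a+1) (inj₁ a≡b+1) =
  ⊥-elim (ℕP.<-irrefl (trans a≡b+1 (cong suc b≡a+1)) (ℕP.m<n+m (toℕ a) (s≤s z≤n)))
Follows-both⇒≤2 (inj₁ b≡a+1) (inj₂ (b-last , a≡0)) =
  ℕP.≤-reflexive (trans (sym b-last) (cong suc (trans b≡a+1 (cong suc a≡0))))
Follows-both⇒≤2 (inj₂ (a-last , b≡0)) (inj₁ a≡b+1) =
  ℕP.≤-reflexive (trans (sym a-last) (cong suc (trans a≡b+1 (cong suc b≡0))))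
Follows-both⇒≤2 (inj₂ (a-last , _)) (inj₂ (_ , a≡0)) =
  subst (_≤ 2) (trans (cong suc (sym a≡0)) a-last) (s≤s z≤n)

Follows-asym : ∀ {n} → 3 ≤ n → {a b : Fin n} → Follows a b → ¬ Follows b a
Follows-asym 3≤n a→b b→a = ℕP.<⇒≱ 3≤n (Follows-both⇒≤2 a→b b→a)

Alternating : (ℕ → ℤ) → Set
Alternating p = ∀ k → p (2 ℕ.+ k) ≡ - p k

-- pat₀ and pat₁ only depend on k % 4, which reduces definitionally on 4 + k.
pat₀-alternating : Alternating pat₀
pat₀-alternating 0 = refl
pat₀-alternating 1 = refl
pat₀-alternating 2 = refl
pat₀-alternating 3 = refl
pat₀-alternating (suc (suc (suc (suc k)))) = pat₀-alternating k

pat₁-alternating : Alternating pat₁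
pat₁-alternating 0 = refl
pat₁-alternating 1 = refl
pat₁-alternating 2 = refl
pat₁-alternating 3 = refl
pat₁-alternating (suc (suc (suc (suc k)))) = pat₁-alternating k

pat₀*pat₁≡0 : ∀ k → pat₀ k * pat₁ k ≡ + 0
pat₀*pat₁≡0 0 = refl
pat₀*pat₁≡0 1 = refl
pat₀*pat₁≡0 2 = refl
pat₀*pat₁≡0 3 = refl
pat₀*pat₁≡0 (suc (suc (suc (suc k)))) = pat₀*pat₁≡0 k

module _ {p : ℕ → ℤ} (alternating : Alternating p) where

  alternating-cancel : ∀ k → p (2 ℕ.+ k) + p k ≡ + 0
  alternating-cancel k = trans (cong (_+ p k) (alternating k)) (+-inverseˡ (p k))

  alternating-periodic : ∀ q r → p (q ℕ.* 4 ℕ.+ r) ≡ p r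
  alternating-periodic zero    r = refl
  alternating-periodic (suc q) r = begin
    p (4 ℕ.+ (q ℕ.* 4 ℕ.+ r))    ≡⟨ alternating (2 ℕ.+ (q ℕ.* 4 ℕ.+ r)) ⟩
    - p (2 ℕ.+ (q ℕ.* 4 ℕ.+ r))  ≡⟨ cong -_ (alternating (q ℕ.* 4 ℕ.+ r)) ⟩
    - - p (q ℕ.* 4 ℕ.+ r)        ≡⟨ neg-involutive _ ⟩
    p (q ℕ.* 4 ℕ.+ r)            ≡⟨ alternating-periodic q r ⟩
    p r                          ∎
    where open ≡-Reasoning

  -- The wrap-around cases need the cycle length to be a multiple of 4.
  alternating-around : ∀ q {a b c : Fin (suc q ℕ.* 4)} → Follows a b → Follows b c →
                       p (toℕ c) + p (toℕ a) ≡ + 0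
  alternating-around q {a} (inj₁ b≡a+1) (inj₁ c≡b+1) =
    trans (cong (λ k → p k + p (toℕ a)) (trans c≡b+1 (cong suc b≡a+1))) (alternating-cancel (toℕ a))
  alternating-around q {a} (inj₁ b≡a+1) (inj₂ (b-last , c≡0)) = begin
    p _ + p (toℕ a)           ≡⟨ cong₂ (λ k l → p k + p l) c≡0 a≡q*4+2 ⟩
    p 0 + p (q ℕ.* 4 ℕ.+ 2)   ≡⟨ cong (λ s → p 0 + s) (alternating-periodic q 2) ⟩
    p 0 + p 2                 ≡⟨ +-comm (p 0) (p 2) ⟩
    p 2 + p 0                 ≡⟨ alternating-cancel 0 ⟩
    + 0                       ∎
    where
    open ≡-Reasoning
    a≡q*4+2 : toℕ a ≡ q ℕ.* 4 ℕ.+ 2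
    a≡q*4+2 = trans (ℕP.suc-injective (ℕP.suc-injective (trans (cong suc (sym b≡a+1)) b-last)))
                    (ℕP.+-comm 2 (q ℕ.* 4))
  alternating-around q {a} (inj₂ (a-last , b≡0)) (inj₁ c≡b+1) = begin
    p _ + p (toℕ a)           ≡⟨ cong₂ (λ k l → p k + p l) (trans c≡b+1 (cong suc b≡0)) a≡q*4+3 ⟩
    p 1 + p (q ℕ.* 4 ℕ.+ 3)   ≡⟨ cong (λ s → p 1 + s) (alternating-periodic q 3) ⟩
    p 1 + p 3                 ≡⟨ +-comm (p 1) (p 3) ⟩
    p 3 + p 1                 ≡⟨ alternating-cancel 1 ⟩
    + 0                       ∎
    where
    open ≡-Reasoning
    a≡q*4+3 : toℕ a ≡ q ℕ.* 4 ℕ.+ 3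
    a≡q*4+3 = trans (ℕP.suc-injective a-last) (ℕP.+-comm 3 (q ℕ.* 4))
  alternating-around q (inj₂ (_ , b≡0)) (inj₂ (b-last , _)) with trans (cong suc (sym b≡0)) b-last
  ... | ()

module CycleMatrix {n} {B : Matrix n} {σ : Fin n ↔ Fin n} (cycle : IsCycleMatrixFor B σ) where

  open Inverse σ using (to; from; strictlyInverseˡ; strictlyInverseʳ)

  private
    3≤n = proj₁ cycle
    adjacent⇒1 = proj₁ (proj₂ cycle)
    apart⇒0 = proj₂ (proj₂ cycle)

  B-entry : ∀ {p a s} → Follows p a → Follows a s → ∀ b → B (to a) (to b) ≡ I s b + I p b
  B-entry {p} {a} {s} p→a a→s b with b FinP.≟ s
  ... | yes refl = trans (adjacent⇒1 a b (inj₁ a→s))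
                     (sym (cong₂ _+_ (I-diagonal b) (I-off-diagonal p≢b)))
    where
    p≢b : p ≢ b
    p≢b refl = Follows-asym 3≤n p→a a→s
  ... | no b≢s with b FinP.≟ p
  ...   | yes refl = trans (adjacent⇒1 a b (inj₂ p→a))
                       (sym (cong₂ _+_ (I-off-diagonal (b≢s ∘ sym)) (I-diagonal b)))
  ...   | no b≢p = trans (apart⇒0 a b apart)
                     (sym (cong₂ _+_ (I-off-diagonal (b≢s ∘ sym)) (I-off-diagonal (b≢p ∘ sym))))
    where
    apart : ¬ (Follows a b ⊎ Follows b a)
    apart (inj₁ a→b) = b≢s (Follows-functional a→b a→s)
    apart (inj₂ b→a) = b≢p (Follows-injective b→a p→a)

  B-▷-neighbours : ∀ {p a s} → Follows p a → Follows a s →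
                   ∀ y → (B ▷ y) (to a) ≡ y (to s) + y (to p)
  B-▷-neighbours {p} {a} {s} p→a a→s y = begin
    ∑ n (λ k → B (to a) k * y k)
      ≡⟨ ∑-permute n _ σ ⟩
    ∑ n (λ b → B (to a) (to b) * y (to b))
      ≡⟨ ∑-cong n (λ b → cong (_* y (to b)) (B-entry p→a a→s b)) ⟩
    ∑ n (λ b → (I s b + I p b) * y (to b))
      ≡⟨ ∑-cong n (λ b → *-distribʳ-+ (y (to b)) (I s b) (I p b)) ⟩
    ∑ n (λ b → I s b * y (to b) + I p b * y (to b))
      ≡⟨ ∑-+ n _ _ ⟩
    ∑ n (λ b → I s b * y (to b)) + ∑ n (λ b → I p b * y (to b))
      ≡⟨ cong₂ _+_ (∑-δ s (y ∘ to)) (∑-δ p (y ∘ to)) ⟩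
    y (to s) + y (to p)
      ∎
    where open ≡-Reasoning

  ker-alternating : ∀ {y} → B ▷ y ≗ zeroV →
                    ∀ {a b c} → Follows a b → Follows b c → y (to c) ≡ - y (to a)
  ker-alternating {y} By≗0 {a} {b} {c} a→b b→c =
    inverseˡ-unique (y (to c)) (y (to a)) (trans (sym (B-▷-neighbours a→b b→c y)) (By≗0 (to b)))

  first second : Fin n
  first  = fromℕ< {0} (ℕP.<-trans (s≤s z≤n) 3≤n)
  second = fromℕ< {1} (ℕP.<-trans (s≤s (s≤s z≤n)) 3≤n)

  module _ {y : Vector n} (By≗0 : B ▷ y ≗ zeroV) where

    private
      y₀ y₁ : ℤ
      y₀ = y (to first)
      y₁ = y (to second)

      fromℕ<-follows : ∀ {k} (k<n : k < n) (k+1<n : suc k < n) →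
                       Follows (fromℕ< k<n) (fromℕ< k+1<n)
      fromℕ<-follows k<n k+1<n =
        inj₁ (trans (FinP.toℕ-fromℕ< k+1<n) (cong suc (sym (FinP.toℕ-fromℕ< k<n))))

      ker-pattern : ∀ k (k<n : k < n) → y (to (fromℕ< k<n)) ≡ y₀ * pat₀ k + y₁ * pat₁ k
      ker-pattern 0 _ = first-coordinate y₀ y₁
        where
        first-coordinate : ∀ u v → u ≡ u * + 1 + v * + 0
        first-coordinate = solve-∀
      ker-pattern 1 _ = second-coordinate y₀ y₁
        where
        second-coordinate : ∀ u v → v ≡ u * + 0 + v * + 1
        second-coordinate = solve-∀
      ker-pattern (suc (suc k)) k+2<n = begin
        y (to (fromℕ< k+2<n))               ≡⟨ ker-alternating By≗0 (fromℕ<-follows k<n k+1<n)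
                                                                   (fromℕ<-follows k+1<n k+2<n) ⟩
        - y (to (fromℕ< k<n))               ≡⟨ cong -_ (ker-pattern k k<n) ⟩
        - (y₀ * pat₀ k + y₁ * pat₁ k)       ≡⟨ neg-distrib y₀ y₁ (pat₀ k) (pat₁ k) ⟩
        y₀ * - pat₀ k + y₁ * - pat₁ k       ≡⟨ cong₂ (λ u v → y₀ * u + y₁ * v)
                                                     (pat₀-alternating k) (pat₁-alternating k) ⟨
        y₀ * pat₀ (2 ℕ.+ k) + y₁ * pat₁ (2 ℕ.+ k) ∎
        where
        open ≡-Reasoning
        k+1<n = ℕP.<-trans (ℕP.n<1+n _) k+2<n
        k<n = ℕP.<-trans (ℕP.n<1+n _) k+1<n
        neg-distrib : ∀ u v s t → - (u * s + v * t) ≡ u * - s + v * - t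
        neg-distrib = solve-∀

    ker-spanned : y ≗ (y (to first) *ᵥ kerU σ) +ᵥ (y (to second) *ᵥ kerW σ)
    ker-spanned i = begin
      y i                        ≡⟨ cong y (strictlyInverseˡ i) ⟨
      y (to (from i))            ≡⟨ cong (y ∘ to) (FinP.fromℕ<-toℕ (from i) i<n) ⟨
      y (to (fromℕ< i<n))        ≡⟨ ker-pattern (toℕ (from i)) i<n ⟩
      y₀ * pat₀ (toℕ (from i)) + y₁ * pat₁ (toℕ (from i)) ∎
      where
      open ≡-Reasoning
      i<n = FinP.toℕ<n (from i)

alternating-∈-ker : ∀ q {B : Matrix (suc q ℕ.* 4)} {σ} → IsCycleMatrixFor B σ →
                    ∀ {p} → Alternating p → B ▷ (p ∘ toℕ ∘ Inverse.from σ) ≗ zeroV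
alternating-∈-ker q {B} {σ} cycle {p} alternating i = begin
  (B ▷ v) i               ≡⟨ cong (B ▷ v) (strictlyInverseˡ i) ⟨
  (B ▷ v) (to a)          ≡⟨ B-▷-neighbours r→a a→s v ⟩
  v (to s) + v (to r)     ≡⟨ cong₂ (λ b c → p (toℕ b) + p (toℕ c)) (strictlyInverseʳ s) (strictlyInverseʳ r) ⟩
  p (toℕ s) + p (toℕ r)   ≡⟨ alternating-around alternating q r→a a→s ⟩
  + 0                     ∎
  where
  open ≡-Reasoning
  open Inverse σ using (to; from; strictlyInverseˡ; strictlyInverseʳ)
  open CycleMatrix {B = B} {σ} cycle using (B-▷-neighbours)
  v = p ∘ toℕ ∘ from
  a = from i
  r = proj₁ (Follows-prev a)
  s = proj₁ (Follows-next a)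
  r→a = proj₂ (Follows-prev a)
  a→s = proj₂ (Follows-next a)

pat₀+pat₁-odd : ∀ k → + 2 Signed.∣ pat₀ k + pat₁ k - + 1
pat₀+pat₁-odd 0 = Signed.divides (+ 0) refl
pat₀+pat₁-odd 1 = Signed.divides (+ 0) refl
pat₀+pat₁-odd 2 = Signed.divides (- + 1) refl
pat₀+pat₁-odd 3 = Signed.divides (- + 1) refl
pat₀+pat₁-odd (suc (suc (suc (suc k)))) = pat₀+pat₁-odd k

⟨⟩-pattern : ∀ {n} (σ : Fin n ↔ Fin n) (p r : ℕ → ℤ) →
             ⟨ p ∘ toℕ ∘ Inverse.from σ , r ∘ toℕ ∘ Inverse.from σ ⟩
               ≡ ∑ n (λ b → p (toℕ b) * r (toℕ b))
⟨⟩-pattern {n} σ p r = trans (∑-permute n _ σ)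
  (∑-cong n (λ b → cong (λ a → p (toℕ a) * r (toℕ a)) (Inverse.strictlyInverseʳ σ b)))

∑-pat₀² : ∀ t → ∑ (t ℕ.* 4) (λ b → pat₀ (toℕ b) * pat₀ (toℕ b)) ≡ + (t ℕ.* 2)
∑-pat₀² zero    = refl
∑-pat₀² (suc t) = cong (λ s → + 1 + (+ 0 + (+ 1 + (+ 0 + s)))) (∑-pat₀² t)

∑-pat₁² : ∀ t → ∑ (t ℕ.* 4) (λ b → pat₁ (toℕ b) * pat₁ (toℕ b)) ≡ + (t ℕ.* 2)
∑-pat₁² zero    = refl
∑-pat₁² (suc t) = cong (λ s → + 0 + (+ 1 + (+ 0 + (+ 1 + s)))) (∑-pat₁² t)

module Restriction (q : ℕ) {d D} {A B : Matrix (suc q ℕ.* 4)} (defect : CyclicDefect A d D B)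
                   {σ} (cycle : IsCycleMatrixFor B σ) where

  open CyclicDefect defect using (adjacency; regular)
  open IsAdjacencyMatrix adjacency using (symmetric)
  open Inverse σ using (to; from)
  open CycleMatrix {B = B} {σ} cycle using (first; second; ker-spanned)

  U W : Vector (suc q ℕ.* 4)
  U = kerU σ
  W = kerW σ

  U⊥W : ⟨ U , W ⟩ ≡ + 0
  U⊥W = trans (⟨⟩-pattern σ pat₀ pat₁)
              (trans (∑-cong (suc q ℕ.* 4) (pat₀*pat₁≡0 ∘ toℕ)) (∑-zero (suc q ℕ.* 4)))

  ⟨U,U⟩ : ⟨ U , U ⟩ ≡ + (suc q ℕ.* 2)
  ⟨U,U⟩ = trans (⟨⟩-pattern σ pat₀ pat₀) (∑-pat₀² (suc q))

  ⟨W,W⟩ : ⟨ W , W ⟩ ≡ + (suc q ℕ.* 2)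
  ⟨W,W⟩ = trans (⟨⟩-pattern σ pat₁ pat₁) (∑-pat₁² (suc q))

  a b c e : ℤ
  a = (A ▷ U) (to first)
  b = (A ▷ U) (to second)
  c = (A ▷ W) (to first)
  e = (A ▷ W) (to second)

  A▷U-span : A ▷ U ≗ (a *ᵥ U) +ᵥ (b *ᵥ W)
  A▷U-span = ker-spanned (ker-invariant (CyclicDefect⇒Commute defect) U
                           (alternating-∈-ker q {B} {σ} cycle pat₀-alternating))

  A▷W-span : A ▷ W ≗ (c *ᵥ U) +ᵥ (e *ᵥ W)
  A▷W-span = ker-spanned (ker-invariant (CyclicDefect⇒Commute defect) W
                           (alternating-∈-ker q {B} {σ} cycle pat₁-alternating))

  c≡b : c ≡ b
  c≡b = restriction-symmetric symmetric {U} {W} U⊥W ⟨U,U⟩ ⟨W,W⟩ {a} {b} {c} {e} A▷U-span A▷W-span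

  -- U + W has odd entries, so A (U + W) agrees modulo 2 with the image d of the all-ones vector.
  A▷U+A▷W≡d : ∀ i → + 2 Signed.∣ (A ▷ U) i + (A ▷ W) i - + d
  A▷U+A▷W≡d i = subst (Signed._∣_ (+ 2))
    (cong₂ _-_ (▷-+ᵥ A U W i) (trans (▷-const {A = A} regular (+ 1) i) (*-identityʳ (+ d))))
    (▷-cong-mod A (U +ᵥ W) (λ _ → + 1) (pat₀+pat₁-odd ∘ toℕ ∘ from) i)

  trace-even : + 2 Signed.∣ a + e
  trace-even = subst (Signed._∣_ (+ 2)) (sym (split a b e (+ d)))
    (∣m∣n⇒∣m+n (∣m∣n⇒∣m+n (subst (λ x → + 2 Signed.∣ a + x - + d) c≡b (A▷U+A▷W≡d (to first)))
                            (A▷U+A▷W≡d (to second)))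
               (Signed.divides (+ d - b) refl))
    where
    split : ∀ a b e d → a + e ≡ (a + b - d) + (b + e - d) + (d - b) * + 2
    split = solve-∀

proposition4 : (n d D : ℕ) (A B : Matrix n) → CyclicDefect A d D B → 4 ∣ n →
    (∀ (x : Vector n) → (∀ i → (B ▷ x) i ≡ + 0) → ∀ i → (B ▷ (A ▷ x)) i ≡ + 0)
    × (∀ σ → IsCycleMatrixFor B σ →
        ∃[ a ] ∃[ b ] ∃[ c ] ∃[ e ]
          ((∀ i → (A ▷ kerU σ) i ≡ ((a *ᵥ kerU σ) +ᵥ (b *ᵥ kerW σ)) i)
          × (∀ i → (A ▷ kerW σ) i ≡ ((c *ᵥ kerU σ) +ᵥ (e *ᵥ kerW σ)) i)
          × (+ 2) ∣ℤ (a + e)))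
proposition4 n d D A B defect (divides zero refl) with proj₁ (proj₂ (CyclicDefect.cycle defect))
... | ()
proposition4 _ d D A B defect (divides (suc q) refl) =
  ker-invariant (CyclicDefect⇒Commute defect) ,
  λ σ cycle → let open Restriction q defect {σ} cycle in
    a , b , c , e , A▷U-span , A▷W-span , ∣⇒∣ᵤ trace-even
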